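{- Every 2-sparse graph $G$ of maximum degree $\Delta(G)\geq 3$ is $\Delta(G)$-edge-colourable.
   Context: Graphs are finite and simple. A graph is 2-sparse if every edge is incident to at least one vertex of degree at most 2. A $k$-edge-colouring assigns colours from $\{1,\dots,k\}$ to edges so that edges sharing an endpoint receive distinct colours. -}

module Defs where

open import Data.Nat using (ℕ; zero; suc; _≤_; _⊔_)
open import Data.Fin using (Fin)
open import Data.Bool using (Bool; true; false; T)
open import Data.List using (List; length; filter; allFin; map; foldr)
open import Data.Product using (_×_; Σ)
open import Data.Sum using (_⊎_)
open import Relation.Binary.PropositionalEquality using (_≡_; _≢_)
open import Relation.Nullary using (¬_)
open import Data.Bool.Properties using (T?)

record Graph (n : ℕ) : Set where
  field
    adj   : Fin n → Fin n → Bool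
    sym   : ∀ u v → adj u v ≡ adj v u
    irrefl : ∀ v → adj v v ≡ false

open Graph public

Adj : ∀ {n} → Graph n → Fin n → Fin n → Set
Adj G u v = T (adj G u v)

deg : ∀ {n} → Graph n → Fin n → ℕ
deg {n} G v = length (filter (λ u → T? (adj G v u)) (allFin n))

-- maximum degree Δ(G) (0 for the empty graph)
maxDeg : ∀ {n} → Graph n → ℕ
maxDeg {n} G = foldr _⊔_ 0 (map (deg G) (allFin n))

TwoSparse : ∀ {n} → Graph n → Set
TwoSparse G = ∀ u v → Adj G u v → (deg G u ≤ 2) ⊎ (deg G v ≤ 2)

-- a k-edge-colouring: a colour in {1..k} (represented by Fin k) for
-- each edge, independent of the orientation of the edge, such that
-- two distinct edges sharing an endpoint get distinct colours.
record EdgeColouring {n} (G : Graph n) (k : ℕ) : Set where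
  field
    colour    : ∀ u v → Adj G u v → Fin k
    symmetric : ∀ u v (e : Adj G u v) (e' : Adj G v u) →
                colour u v e ≡ colour v u e'
    proper    : ∀ u v w (e : Adj G u v) (e' : Adj G u w) →
                v ≢ w → colour u v e ≢ colour u w e'

EdgeColourable : ∀ {n} → Graph n → ℕ → Set
EdgeColourable G k = EdgeColouring G k

module Submission where

-- Call a vertex light if its degree is at most 2 and heavy otherwise; by 2-sparseness every
-- edge has a light end. First colour the edges with a heavy end, one at a time. The graph
-- coloured so far is then bipartite between light and heavy vertices, so when the edge ab
-- (a heavy, b light) is added, a misses some colour α since deg a ≤ Δ, and b misses some β
-- since it has at most one coloured edge. Exchanging α and β on the α/β-path that starts at b
-- frees α at b; the path never enters a, because a vertex on the heavy side is entered only
-- along an α-edge. Finally add the light–light edges: each end has at most one other edge, so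
-- at most two colours are blocked and Δ ≥ 3 leaves one free.

open import Defs hiding (sym)
open import Data.Nat using (ℕ; zero; suc; _≤_; _⊔_; z≤n; s≤s; _≤?_)
open import Data.Nat.Properties using (≰⇒>; m≤m⊔n; m≤n⇒m≤o⊔n; ≤-trans; ≤-<-trans; 1+n≰n)
open import Data.Fin using (Fin; zero; suc; _≟_; fromℕ<)
open import Data.Fin.Properties using (pigeonhole; <⇒≢; any?; all?; ¬∀⟶∃¬)
open import Data.Fin.Subset using (Subset; _∈_; _∉_; _⊆_; _⊂_; _∪_; ⁅_⁆; ∣_∣)
open import Data.Fin.Subset.Properties using (_∈?_; _⊂?_; p⊂q⇒∣p∣<∣q∣; ∣p∣≤n; x∈p∪q⁺; x∈p∪q⁻; x∈⁅x⁆; x∈⁅y⁆⇒x≡y; p⊆p∪q)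
open import Data.Fin.Permutation.Components using (transpose; transpose-inverse)
open import Data.Bool using (Bool; true; false; T; not; _∧_; if_then_else_)
import Data.Bool as Bool
open import Data.Bool.Properties using (T-∧; T?; T-irrelevant; ¬-not; not-injective)
open import Data.List using (List; []; _∷_; _++_; length; allFin; map; foldr; lookup; filter; cartesianProduct)
open import Data.List.Membership.Propositional using () renaming (_∈_ to _∈ˡ_)
open import Data.List.Membership.Propositional.Properties using (∈-filter⁺; ∈-allFin; ∈-++⁺ˡ; ∈-++⁺ʳ; ∈-cartesianProduct⁺)
open import Data.List.Relation.Unary.All as All using (All; []; _∷_)
open import Data.List.Relation.Unary.All.Properties using (all-filter)
open import Data.List.Relation.Unary.Any using (here; there; index)
open import Data.List.Relation.Unary.Any.Properties using (lookup-index)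
open import Data.Vec using (tabulate)
import Data.Vec.Functional as Vector
import Data.List.Membership.DecPropositional as DecMembership
open import Data.Product.Properties using (≡-dec)
open import Data.Vec.Properties using (lookup∘tabulate; lookup⇒[]=; []=⇒lookup)
open import Data.Product using (Σ; ∃; _×_; _,_; proj₁; proj₂; swap)
open import Data.Sum using (_⊎_; inj₁; inj₂; [_,_]′)
import Data.Sum as Sum
open import Function using (_∘_; id; flip)
open import Function.Definitions using (Injective)
open import Relation.Binary.Definitions using (Decidable)
open import Relation.Nullary using (¬_; Dec; yes; no; does; contradiction)
open import Relation.Nullary.Decidable using (¬?; isYes; isYes≗does; map′; _×-dec_; _⊎-dec_; toWitness; fromWitness; dec-true; dec-false; does-⇔; decidable-stable)
open import Function.Bundles using (_⇔_; mk⇔; Equivalence)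
open import Relation.Binary.PropositionalEquality using (_≡_; _≢_; refl; sym; trans; cong; cong₂; subst; module ≡-Reasoning)

private
  variable
    n m k : ℕ

injection⇒≤length : ∀ {a} {A : Set a} (xs : List A) (f : Fin m → A) →
                    Injective _≡_ _≡_ f → (∀ i → f i ∈ˡ xs) → m ≤ length xs
injection⇒≤length {m} xs f f-inj f∈xs with m ≤? length xs
... | yes m≤∣xs∣ = m≤∣xs∣
... | no m≰∣xs∣ =
  let i , j , i<j , same-index = pigeonhole (≰⇒> m≰∣xs∣) (index ∘ f∈xs)
  in contradiction (f-inj (begin
       f i                          ≡⟨ lookup-index (f∈xs i) ⟩
       lookup xs (index (f∈xs i))   ≡⟨ cong (lookup xs) same-index ⟩
       lookup xs (index (f∈xs j))   ≡⟨ lookup-index (f∈xs j) ⟨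
       f j                          ∎)) (<⇒≢ i<j)
  where open ≡-Reasoning

Adj-sym : (G : Graph n) {x y : Fin n} → Adj G x y → Adj G y x
Adj-sym G {x} {y} = subst T (Graph.sym G x y)

Adj-irrefl : (G : Graph n) {x : Fin n} → ¬ Adj G x x
Adj-irrefl G {x} = subst T (irrefl G x)

injection⇒≤deg : (G : Graph n) (x : Fin n) (f : Fin m → Fin n) →
                 Injective _≡_ _≡_ f → (∀ i → Adj G x (f i)) → m ≤ deg G x
injection⇒≤deg G x f f-inj adj-f =
  injection⇒≤length _ f f-inj (λ i → ∈-filter⁺ (T? ∘ adj G x) (∈-allFin (f i)) (adj-f i))

deg≤maxDeg : (G : Graph n) (x : Fin n) → deg G x ≤ maxDeg G
deg≤maxDeg G x = ≤-foldr⊔ (deg G) (∈-allFin x)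
  where
  ≤-foldr⊔ : ∀ {A : Set} (g : A → ℕ) {xs : List A} {y : A} → y ∈ˡ xs → g y ≤ foldr _⊔_ 0 (map g xs)
  ≤-foldr⊔ g {x ∷ _} (here refl) = m≤m⊔n (g x) _
  ≤-foldr⊔ g {x ∷ _} (there y∈xs) = m≤n⇒m≤o⊔n (g x) (≤-foldr⊔ g y∈xs)

_⊆ᴳ_ : Graph n → Graph n → Set
H ⊆ᴳ G = ∀ {x y} → Adj H x y → Adj G x y

module _ {H : Graph n} (c : EdgeColouring H k) where
  open EdgeColouring c

  colour-cong : ∀ {x y z} (e : Adj H x y) (e' : Adj H x z) → y ≡ z → colour x y e ≡ colour x z e'
  colour-cong e e' refl = cong (colour _ _) (T-irrelevant e e')

  colour-sym : ∀ {x y} (e : Adj H x y) → colour y x (Adj-sym H e) ≡ colour x y e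
  colour-sym e = symmetric _ _ (Adj-sym H e) e

  Misses : Fin n → Fin k → Set
  Misses x α = ∀ y (e : Adj H x y) → colour x y e ≢ α

  Hits : Fin n → Fin k → Set
  Hits x α = ∃ λ y → Σ (Adj H x y) λ e → colour x y e ≡ α

  hits? : ∀ x α → Dec (Hits x α)
  hits? x α = any? edge-of-colour?
    where
    edge-of-colour? : ∀ y → Dec (Σ (Adj H x y) λ e → colour x y e ≡ α)
    edge-of-colour? y with T? (adj H x y)
    ... | no ¬e = no (¬e ∘ proj₁)
    ... | yes e = map′ (e ,_) (λ (e' , eq) → trans (colour-cong e e' refl) eq) (colour x y e ≟ α)

restrict : {H H' : Graph n} → H' ⊆ᴳ H → EdgeColouring H k → EdgeColouring H' k
restrict H'⊆H c = record
  { colour    = λ x y e → colour x y (H'⊆H e)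
  ; symmetric = λ x y e e' → symmetric x y (H'⊆H e) (H'⊆H e')
  ; proper    = λ x y z e e' → proper x y z (H'⊆H e) (H'⊆H e')
  }
  where open EdgeColouring c

module _ (G : Graph n) {H : Graph n} (H⊆G : H ⊆ᴳ G) {x v : Fin n} (xv∈G : Adj G x v) (xv∉H : ¬ Adj H x v) where

  injection⇒<deg : (f : Fin m → Fin n) → Injective _≡_ _≡_ f → (∀ i → Adj H x (f i)) → suc m ≤ deg G x
  injection⇒<deg f f-inj adj-f = injection⇒≤deg G x (v Vector.∷ f) v∷f-inj adj-v∷f
    where
    adj-v∷f : ∀ i → Adj G x ((v Vector.∷ f) i)
    adj-v∷f zero    = xv∈G
    adj-v∷f (suc i) = H⊆G (adj-f i)

    v∷f-inj : Injective _≡_ _≡_ (v Vector.∷ f)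
    v∷f-inj {zero}  {zero}  _    = refl
    v∷f-inj {zero}  {suc j} v≡fj = contradiction (subst (Adj H x) (sym v≡fj) (adj-f j)) xv∉H
    v∷f-inj {suc i} {zero}  fi≡v = contradiction (subst (Adj H x) fi≡v (adj-f i)) xv∉H
    v∷f-inj {suc i} {suc j} eq   = cong suc (f-inj eq)

  misses-some-colour : (c : EdgeColouring H k) → deg G x ≤ k → ∃ (Misses c x)
  misses-some-colour {k = k} c deg≤k with all? (hits? c x)
  ... | no ¬all-hit =
    let α , ¬hit = ¬∀⟶∃¬ _ _ (hits? c x) ¬all-hit in α , λ y e eq → ¬hit (y , e , eq)
  ... | yes all-hit = contradiction (≤-trans (injection⇒<deg end end-inj (proj₁ ∘ proj₂ ∘ all-hit)) deg≤k) 1+n≰n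
    where
    open ≡-Reasoning
    end : Fin k → Fin n
    end = proj₁ ∘ all-hit

    end-inj : Injective _≡_ _≡_ end
    end-inj {α} {β} same-end = begin
      α                                          ≡⟨ proj₂ (proj₂ (all-hit α)) ⟨
      colour c x (end α) (proj₁ (proj₂ (all-hit α))) ≡⟨ colour-cong c _ _ same-end ⟩
      colour c x (end β) (proj₁ (proj₂ (all-hit β))) ≡⟨ proj₂ (proj₂ (all-hit β)) ⟩
      β                                          ∎
      where open EdgeColouring

  at-most-one-neighbour : deg G x ≤ 2 → ∀ {y z} → Adj H x y → Adj H x z → y ≡ z
  at-most-one-neighbour deg≤2 {y} {z} xy xz = decidable-stable (y ≟ z) λ y≢z →
    contradiction (≤-trans (injection⇒<deg (y Vector.∷ z Vector.∷ Vector.[]) (pair-inj y≢z) adj-pair) deg≤2) 1+n≰n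
    where
    pair-inj : y ≢ z → Injective _≡_ _≡_ (y Vector.∷ z Vector.∷ Vector.[])
    pair-inj _   {zero}     {zero}     _  = refl
    pair-inj y≢z {zero}     {suc zero} eq = contradiction eq y≢z
    pair-inj y≢z {suc zero} {zero}     eq = contradiction (sym eq) y≢z
    pair-inj _   {suc zero} {suc zero} _  = refl

    adj-pair : ∀ i → Adj H x ((y Vector.∷ z Vector.∷ Vector.[]) i)
    adj-pair zero       = xy
    adj-pair (suc zero) = xz

  -- The colour argument is only returned when x has no edge in H at all.
  misses-all-but-one : (c : EdgeColouring H k) → Fin k → deg G x ≤ 2 →
                       ∃ λ γ → ∀ α → α ≢ γ → Misses c x α
  misses-all-but-one c γ₀ deg≤2 with any? (T? ∘ adj H x)
  ... | no no-edge = γ₀ , λ _ _ y e _ → no-edge (y , e)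
  ... | yes (y₀ , e₀) = colour c x y₀ e₀ , λ α α≢γ y e colour≡α →
    α≢γ (trans (sym colour≡α) (colour-cong c e e₀ (at-most-one-neighbour deg≤2 e e₀)))
    where open EdgeColouring

⊆-⊄⇒⊇ : {p q : Subset n} → p ⊆ q → ¬ p ⊂ q → q ⊆ p
⊆-⊄⇒⊇ {p = p} p⊆q p⊄q {x} x∈q with x ∈? p
... | yes x∈p = x∈p
... | no x∉p  = contradiction ((λ {y} → p⊆q {y}) , x , x∈q , x∉p) p⊄q

⊆-chain-stationary : (P : ℕ → Subset n) → (∀ i → P i ⊆ P (suc i)) → ∃ λ j → P (suc j) ⊆ P j
⊆-chain-stationary {n} P P-mono with stationary-or-large (suc n)
  where
  -- A chain without a stationary step gains an element at every step.
  stationary-or-large : ∀ i → (∃ λ j → P (suc j) ⊆ P j) ⊎ i ≤ ∣ P i ∣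
  stationary-or-large zero = inj₂ z≤n
  stationary-or-large (suc i) with stationary-or-large i
  ... | inj₁ found = inj₁ found
  ... | inj₂ i≤∣Pi∣ with P i ⊂? P (suc i)
  ...   | yes Pi⊂Psi = inj₂ (≤-<-trans i≤∣Pi∣ (p⊂q⇒∣p∣<∣q∣ Pi⊂Psi))
  ...   | no Pi⊄Psi  = inj₁ (i , ⊆-⊄⇒⊇ (P-mono i) Pi⊄Psi)
... | inj₁ found = found
... | inj₂ large = contradiction (≤-trans large (∣p∣≤n (P (suc n)))) 1+n≰n

module _ {P : Fin n → Set} (P? : ∀ x → Dec (P x)) where

  ∈-tabulate⁺ : ∀ {x} → P x → x ∈ tabulate (does ∘ P?)
  ∈-tabulate⁺ {x} px = lookup⇒[]= x _ (trans (lookup∘tabulate _ x) (dec-true (P? x) px))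

  ∈-tabulate⁻ : ∀ {x} → x ∈ tabulate (does ∘ P?) → P x
  ∈-tabulate⁻ {x} x∈ with P? x | trans (sym (lookup∘tabulate (does ∘ P?) x)) ([]=⇒lookup x∈)
  ... | yes px | _  = px
  ... | no _   | ()

module Reachability {Step : Fin n → Fin n → Set} (step? : Decidable Step) (source : Fin n) where

  successor? : (p : Subset n) (y : Fin n) → Dec (∃ λ x → x ∈ p × Step x y)
  successor? p y = any? λ x → x ∈? p ×-dec step? x y

  successors : Subset n → Subset n
  successors p = tabulate (does ∘ successor? p)

  within : ℕ → Subset n
  within zero    = ⁅ source ⁆
  within (suc i) = within i ∪ successors (within i)

  within-mono : ∀ i → within i ⊆ within (suc i)
  within-mono i = p⊆p∪q _

  stable-stage : ∃ λ j → within (suc j) ⊆ within j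
  stable-stage = ⊆-chain-stationary within within-mono

  reachable : Subset n
  reachable = within (proj₁ stable-stage)

  source∈reachable : source ∈ reachable
  source∈reachable = source∈within (proj₁ stable-stage)
    where
    source∈within : ∀ i → source ∈ within i
    source∈within zero    = x∈⁅x⁆ source
    source∈within (suc i) = within-mono i (source∈within i)

  reachable-closed : ∀ {x y} → x ∈ reachable → Step x y → y ∈ reachable
  reachable-closed x∈R xy = proj₂ stable-stage
    (x∈p∪q⁺ (inj₂ (∈-tabulate⁺ (successor? reachable) (_ , x∈R , xy))))

  reachable-origin : ∀ {y} → y ∈ reachable → y ≡ source ⊎ ∃ λ x → x ∈ reachable × Step x y
  reachable-origin = origin (proj₁ stable-stage)
    where
    origin : ∀ i {y} → y ∈ within i → y ≡ source ⊎ ∃ λ x → x ∈ within i × Step x y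
    origin zero    y∈ = inj₁ (x∈⁅y⁆⇒x≡y source y∈)
    origin (suc i) y∈ with x∈p∪q⁻ (within i) _ y∈
    ... | inj₂ y∈succ = let x , x∈ , xy = ∈-tabulate⁻ (successor? (within i)) y∈succ in inj₂ (x , within-mono i x∈ , xy)
    ... | inj₁ y∈within with origin i y∈within
    ...   | inj₁ y≡source        = inj₁ y≡source
    ...   | inj₂ (x , x∈ , xy)   = inj₂ (x , within-mono i x∈ , xy)

transpose-matchʳ : (i j : Fin k) → transpose i j j ≡ i
transpose-matchʳ i j with j ≟ i
... | yes j≡i = j≡i
... | no _ rewrite dec-true (j ≟ j) refl = refl

transpose-mismatch : {i j l : Fin k} → l ≢ i → l ≢ j → transpose i j l ≡ l
transpose-mismatch {i = i} {j} {l} l≢i l≢j rewrite dec-false (l ≟ i) l≢i | dec-false (l ≟ j) l≢j = refl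

transpose-injective : (i j : Fin k) → Injective _≡_ _≡_ (transpose i j)
transpose-injective i j {l} {l'} eq = begin
  l                               ≡⟨ transpose-inverse j i ⟨
  transpose j i (transpose i j l)  ≡⟨ cong (transpose j i) eq ⟩
  transpose j i (transpose i j l') ≡⟨ transpose-inverse j i ⟩
  l'                              ∎
  where open ≡-Reasoning

module KempeSwitch {H : Graph n} (c : EdgeColouring H k) (side : Fin n → Bool)
                   (crossing : ∀ {x y} → Adj H x y → side x ≢ side y) (α β : Fin k) where
  open EdgeColouring c
  open ≡-Reasoning

  stepColour : Bool → Fin k
  stepColour true  = α
  stepColour false = β

  -- Edges coloured α are traversed from side true to side false, edges coloured β back.
  Step : Fin n → Fin n → Set
  Step x y = Σ (Adj H x y) λ e → colour x y e ≡ stepColour (side x)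

  step? : Decidable Step
  step? x y with T? (adj H x y)
  ... | no ¬e = no (¬e ∘ proj₁)
  ... | yes e = map′ (e ,_) (λ (e' , eq) → trans (colour-cong c e e' refl) eq)
                     (colour x y e ≟ stepColour (side x))

  step-source-side : ∀ {x z} → Step z x → side z ≡ not (side x)
  step-source-side (e , _) = ¬-not (crossing e)

  no-step-into : ∀ {x z} → Misses c x (stepColour (not (side x))) → ¬ Step z x
  no-step-into {x} {z} miss zx@(e , eq) = miss z (Adj-sym H e) (begin
    colour x z (Adj-sym H e)  ≡⟨ colour-sym c e ⟩
    colour z x e              ≡⟨ eq ⟩
    stepColour (side z)       ≡⟨ cong stepColour (step-source-side zx) ⟩
    stepColour (not (side x)) ∎)

  step-into-unique : ∀ {x y z} → Step y x → Step z x → y ≡ z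
  step-into-unique {x} {y} {z} yx@(e , eq) zx@(e' , eq') = decidable-stable (y ≟ z) λ y≢z →
    proper x y z (Adj-sym H e) (Adj-sym H e') y≢z (begin
      colour x y (Adj-sym H e)   ≡⟨ colour-sym c e ⟩
      colour y x e               ≡⟨ eq ⟩
      stepColour (side y)        ≡⟨ cong stepColour (trans (step-source-side yx) (sym (step-source-side zx))) ⟩
      stepColour (side z)        ≡⟨ eq' ⟨
      colour z x e'              ≡⟨ colour-sym c e' ⟨
      colour x z (Adj-sym H e')  ∎)

  edge-step : ∀ {x y} (e : Adj H x y) (s : Bool) → colour x y e ≡ stepColour s → Step x y ⊎ Step y x
  edge-step {x} {y} e s eq with side x Bool.≟ s
  ... | yes refl = inj₁ (e , eq)
  ... | no x≢s   = inj₂ (Adj-sym H e , (begin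
    colour y x (Adj-sym H e) ≡⟨ colour-sym c e ⟩
    colour x y e             ≡⟨ eq ⟩
    stepColour s             ≡⟨ cong stepColour y≡s ⟨
    stepColour (side y)      ∎))
    where
    y≡s : side y ≡ s
    y≡s = not-injective (trans (sym (¬-not (crossing e))) (¬-not x≢s))

  module Switch (b : Fin n) (b-source : Misses c b (stepColour (not (side b)))) where
    open Reachability step? b public

    reachable-backward : ∀ {x y} → x ∈ reachable → Step y x → y ∈ reachable
    reachable-backward x∈R yx with reachable-origin x∈R
    ... | inj₁ refl             = contradiction yx (no-step-into b-source)
    ... | inj₂ (z , z∈R , zx)   = subst (_∈ reachable) (step-into-unique zx yx) z∈R

    reachable-edge : ∀ {x y} (e : Adj H x y) (s : Bool) → colour x y e ≡ stepColour s →
                     x ∈ reachable ⇔ y ∈ reachable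
    reachable-edge e s eq with edge-step e s eq
    ... | inj₁ xy = mk⇔ (λ x∈R → reachable-closed x∈R xy) (λ y∈R → reachable-backward y∈R xy)
    ... | inj₂ yx = mk⇔ (λ x∈R → reachable-backward x∈R yx) (λ y∈R → reachable-closed y∈R yx)

    switchAt : Fin n → Fin k → Fin k
    switchAt x γ = if does (x ∈? reachable) then transpose α β γ else γ

    switchAt-inside : ∀ {x γ} → x ∈ reachable → switchAt x γ ≡ transpose α β γ
    switchAt-inside {x} x∈R rewrite dec-true (x ∈? reachable) x∈R = refl

    switchAt-outside : ∀ {x γ} → x ∉ reachable → switchAt x γ ≡ γ
    switchAt-outside {x} x∉R rewrite dec-false (x ∈? reachable) x∉R = refl

    switchAt-fix : ∀ x {γ} → γ ≢ α → γ ≢ β → switchAt x γ ≡ γ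
    switchAt-fix x γ≢α γ≢β with x ∈? reachable
    ... | yes _ = transpose-mismatch γ≢α γ≢β
    ... | no _  = refl

    switchAt-injective : ∀ x → Injective _≡_ _≡_ (switchAt x)
    switchAt-injective x with x ∈? reachable
    ... | yes _ = transpose-injective α β
    ... | no _  = id

    switchAt-edge : ∀ {x y} (e : Adj H x y) → switchAt x (colour x y e) ≡ switchAt y (colour x y e)
    switchAt-edge {x} {y} e = agree (colour x y e ≟ α) (colour x y e ≟ β)
      where
      same-switch : ∀ s → colour x y e ≡ stepColour s → switchAt x (colour x y e) ≡ switchAt y (colour x y e)
      same-switch s eq = cong (λ t → if t then _ else _)
                              (does-⇔ (reachable-edge e s eq) (x ∈? reachable) (y ∈? reachable))

      agree : Dec (colour x y e ≡ α) → Dec (colour x y e ≡ β) →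
              switchAt x (colour x y e) ≡ switchAt y (colour x y e)
      agree (yes ≡α) _       = same-switch true ≡α
      agree (no _)  (yes ≡β) = same-switch false ≡β
      agree (no ≢α) (no ≢β)  = trans (switchAt-fix x ≢α ≢β) (sym (switchAt-fix y ≢α ≢β))

    switched : EdgeColouring H k
    switched = record
      { colour    = λ x y e → switchAt x (colour x y e)
      ; symmetric = λ x y e e' → trans (switchAt-edge e) (cong (switchAt y) (symmetric x y e e'))
      ; proper    = λ x y z e e' y≢z eq → proper x y z e e' y≢z (switchAt-injective x eq)
      }

kempe-switch : {H : Graph n} (side : Fin n → Bool) → (∀ {x y} → Adj H x y → side x ≢ side y) →
               (c : EdgeColouring H k) {a b : Fin n} {α β : Fin k} → side a ≡ false → side b ≡ true →
               Misses c a α → Misses c b β → Σ (EdgeColouring H k) λ c' → Misses c' a α × Misses c' b α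
kempe-switch side crossing c {a} {b} {α} {β} a-false b-true a-misses b-misses =
  switched , a-misses′ , b-misses′
  where
  open KempeSwitch c side crossing α β
  open Switch b (subst (λ s → Misses c b (stepColour (not s))) (sym b-true) b-misses)

  a∉R : a ∉ reachable
  a∉R a∈R with reachable-origin a∈R
  ... | inj₁ refl          = contradiction (trans (sym a-false) b-true) λ ()
  ... | inj₂ (_ , _ , za)  = no-step-into (subst (λ s → Misses c a (stepColour (not s))) (sym a-false) a-misses) za

  a-misses′ : Misses switched a α
  a-misses′ y e eq = a-misses y e (trans (sym (switchAt-outside a∉R)) eq)

  b-misses′ : Misses switched b α
  b-misses′ y e eq = b-misses y e (transpose-injective α β (begin
    transpose α β (colour c b y e) ≡⟨ switchAt-inside source∈reachable ⟨
    switchAt b (colour c b y e)    ≡⟨ eq ⟩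
    α                              ≡⟨ transpose-matchʳ α β ⟨
    transpose α β β                ∎))
    where open EdgeColouring
          open ≡-Reasoning

fresh-colour : 3 ≤ k → (γ δ : Fin k) → ∃ λ α → α ≢ γ × α ≢ δ
fresh-colour (s≤s (s≤s (s≤s _))) γ δ with zero ≟ γ | zero ≟ δ
... | no 0≢γ   | no 0≢δ   = zero , 0≢γ , 0≢δ
... | yes refl | yes refl = suc zero , (λ ()) , (λ ())
... | yes refl | no _ with suc zero ≟ δ
...   | no 1≢δ   = suc zero , (λ ()) , 1≢δ
...   | yes refl = suc (suc zero) , (λ ()) , (λ ())
fresh-colour (s≤s (s≤s (s≤s _))) γ δ | no _ | yes refl with suc zero ≟ γ
...   | no 1≢γ   = suc zero , 1≢γ , (λ ())
...   | yes refl = suc (suc zero) , (λ ()) , (λ ())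

_≡ᵘ_ : {A : Set} → A × A → A × A → Set
p ≡ᵘ q = p ≡ q ⊎ swap p ≡ q

≡ᵘ-unique : {A : Set} {x y z u v : A} → u ≢ v → (x , y) ≡ᵘ (u , v) → (x , z) ≡ᵘ (u , v) → y ≡ z
≡ᵘ-unique _   (inj₁ refl) (inj₁ refl) = refl
≡ᵘ-unique u≢v (inj₁ refl) (inj₂ refl) = contradiction refl u≢v
≡ᵘ-unique u≢v (inj₂ refl) (inj₁ refl) = contradiction refl u≢v
≡ᵘ-unique _   (inj₂ refl) (inj₂ refl) = refl

Adj-≡ᵘ : (H : Graph n) {x y u v : Fin n} → Adj H u v → (x , y) ≡ᵘ (u , v) → Adj H x y
Adj-≡ᵘ H uv (inj₁ refl) = uv
Adj-≡ᵘ H uv (inj₂ refl) = Adj-sym H uv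

Misses-≡ᵘ : {H : Graph n} (c : EdgeColouring H k) {x y u v : Fin n} {α : Fin k} →
            Misses c u α → Misses c v α → (x , y) ≡ᵘ (u , v) → Misses c x α
Misses-≡ᵘ c u-misses _ (inj₁ refl) = u-misses
Misses-≡ᵘ c _ v-misses (inj₂ refl) = v-misses

add-edge : {H H' : Graph n} {u v : Fin n} {α : Fin k} →
           (∀ {x y} → Adj H' x y → Adj H x y ⊎ (x , y) ≡ᵘ (u , v)) → u ≢ v →
           (c : EdgeColouring H k) → Misses c u α → Misses c v α → EdgeColouring H' k
add-edge {k = k} {H = H} {H'} {u} {v} {α} H'⊆H+uv u≢v c u-misses v-misses = record
  { colour    = λ x y _ → paint x y (T? (adj H x y))
  ; symmetric = λ x y _ _ → paint-sym x y (T? (adj H x y)) (T? (adj H y x))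
  ; proper    = λ x y z e e' → paint-proper x y z (T? (adj H x y)) (T? (adj H x z)) e e'
  }
  where
  open EdgeColouring c

  paint : ∀ x y → Dec (Adj H x y) → Fin k
  paint x y (yes e) = colour x y e
  paint x y (no _)  = α

  paint-sym : ∀ x y (d : Dec (Adj H x y)) (d' : Dec (Adj H y x)) → paint x y d ≡ paint y x d'
  paint-sym x y (yes e) (yes e') = symmetric x y e e'
  paint-sym x y (yes e) (no ¬e') = contradiction (Adj-sym H e) ¬e'
  paint-sym x y (no ¬e) (yes e') = contradiction (Adj-sym H e') ¬e
  paint-sym x y (no _)  (no _)   = refl

  new-edge : ∀ {x y} → Adj H' x y → ¬ Adj H x y → (x , y) ≡ᵘ (u , v)
  new-edge e ¬e = [ flip contradiction ¬e , id ]′ (H'⊆H+uv e)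

  paint-proper : ∀ x y z (d : Dec (Adj H x y)) (d' : Dec (Adj H x z)) → Adj H' x y → Adj H' x z →
                 y ≢ z → paint x y d ≢ paint x z d'
  paint-proper x y z (yes e) (yes e') _  _   = proper x y z e e'
  paint-proper x y z (yes e) (no ¬e') _  xz _ = Misses-≡ᵘ c u-misses v-misses (new-edge xz ¬e') y e
  paint-proper x y z (no ¬e) (yes e') xy _  _ = Misses-≡ᵘ c u-misses v-misses (new-edge xy ¬e) z e' ∘ sym
  paint-proper x y z (no ¬e) (no ¬e') xy xz y≢z _ = y≢z (≡ᵘ-unique u≢v (new-edge xy ¬e) (new-edge xz ¬e'))

edgeless-colouring : {H : Graph n} → (∀ {x y} → ¬ Adj H x y) → EdgeColouring H k
edgeless-colouring no-edge = record
  { colour    = λ _ _ e → contradiction e no-edge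
  ; symmetric = λ _ _ e _ → contradiction e no-edge
  ; proper    = λ _ _ _ e _ _ → contradiction e no-edge
  }

Listed : List (Fin n × Fin n) → Fin n → Fin n → Set
Listed L x y = (x , y) ∈ˡ L ⊎ (y , x) ∈ˡ L

listed? : (L : List (Fin n × Fin n)) (x y : Fin n) → Dec (Listed L x y)
listed? L x y = (x , y) ∈ˡ? L ⊎-dec (y , x) ∈ˡ? L
  where open DecMembership (≡-dec _≟_ _≟_) using () renaming (_∈?_ to _∈ˡ?_)

Listed-sym : (L : List (Fin n × Fin n)) {x y : Fin n} → Listed L x y → Listed L y x
Listed-sym L = Sum.swap

_↾_ : Graph n → List (Fin n × Fin n) → Graph n
G ↾ L = record
  { adj    = λ x y → adj G x y ∧ isYes (listed? L x y)
  ; sym    = λ x y → cong₂ _∧_ (Graph.sym G x y) (listed-sym x y)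
  ; irrefl = λ x → cong (_∧ isYes (listed? L x x)) (irrefl G x)
  }
  where
  listed-sym : ∀ x y → isYes (listed? L x y) ≡ isYes (listed? L y x)
  listed-sym x y = begin
    isYes (listed? L x y) ≡⟨ isYes≗does _ ⟩
    does (listed? L x y)  ≡⟨ does-⇔ (mk⇔ (Listed-sym L) (Listed-sym L)) (listed? L x y) (listed? L y x) ⟩
    does (listed? L y x)  ≡⟨ isYes≗does _ ⟨
    isYes (listed? L y x) ∎
    where open ≡-Reasoning

module _ (G : Graph n) where

  ↾-⊆ : ∀ L → (G ↾ L) ⊆ᴳ G
  ↾-⊆ L {x} {y} = proj₁ ∘ Equivalence.to (T-∧ {adj G x y})

  ↾⁻ : ∀ L {x y} → Adj (G ↾ L) x y → Listed L x y
  ↾⁻ L {x} {y} e = toWitness {a? = listed? L x y} (proj₂ (Equivalence.to (T-∧ {adj G x y}) e))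

  ↾⁺ : ∀ L {x y} → Adj G x y → Listed L x y → Adj (G ↾ L) x y
  ↾⁺ L {x} {y} e listed = Equivalence.from (T-∧ {adj G x y}) (e , fromWitness {a? = listed? L x y} listed)

  ↾-∷⁻ : ∀ p L {x y} → Adj (G ↾ (p ∷ L)) x y → Adj (G ↾ L) x y ⊎ (x , y) ≡ᵘ p
  ↾-∷⁻ p L e with ↾⁻ (p ∷ L) e
  ... | inj₁ (here refl)  = inj₂ (inj₁ refl)
  ... | inj₂ (here refl)  = inj₂ (inj₂ refl)
  ... | inj₁ (there xy∈L) = inj₁ (↾⁺ L (↾-⊆ (p ∷ L) e) (inj₁ xy∈L))
  ... | inj₂ (there yx∈L) = inj₁ (↾⁺ L (↾-⊆ (p ∷ L) e) (inj₂ yx∈L))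

  ↾-[] : ∀ {x y} → ¬ Adj (G ↾ []) x y
  ↾-[] e with ↾⁻ [] e
  ... | inj₁ ()
  ... | inj₂ ()

module TwoSparseColouring (G : Graph n) (sparse : TwoSparse G) (3≤k : 3 ≤ k) (deg≤k : ∀ x → deg G x ≤ k) where

  Light : Fin n → Set
  Light x = deg G x ≤ 2

  light? : ∀ x → Dec (Light x)
  light? x = deg G x ≤? 2

  NoLightEdge : Graph n → Set
  NoLightEdge H = ∀ {x y} → Adj H x y → ¬ (Light x × Light y)

  light-side-crossing : {H : Graph n} → H ⊆ᴳ G → NoLightEdge H →
                        ∀ {x y} → Adj H x y → does (light? x) ≢ does (light? y)
  light-side-crossing H⊆G no-light {x} {y} e = crossing (light? x) (light? y)
    where
    crossing : (x? : Dec (Light x)) (y? : Dec (Light y)) → does x? ≢ does y?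
    crossing (yes lx) (yes ly) _ = no-light e (lx , ly)
    crossing (no hx)  (no hy)  _ = [ hx , hy ]′ (sparse x y (H⊆G e))
    crossing (yes _)  (no _)   ()
    crossing (no _)   (yes _)  ()

  someColour : Fin k
  someColour = fromℕ< (≤-trans (s≤s z≤n) 3≤k)

  MissingInCommon : {H : Graph n} → EdgeColouring H k → Fin n → Fin n → Set
  MissingInCommon c u v = ∃ λ α → Misses c u α × Misses c v α

  module _ {H : Graph n} (H⊆G : H ⊆ᴳ G) {u v : Fin n} (uv∈G : Adj G u v) (uv∉H : ¬ Adj H u v) where

    vu∈G : Adj G v u
    vu∈G = Adj-sym G uv∈G

    vu∉H : ¬ Adj H v u
    vu∉H = uv∉H ∘ Adj-sym H

    light-light-missing : (c : EdgeColouring H k) → Light u → Light v → MissingInCommon c u v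
    light-light-missing c lu lv =
      let γ , u-misses = misses-all-but-one G H⊆G uv∈G uv∉H c someColour lu
          δ , v-misses = misses-all-but-one G H⊆G vu∈G vu∉H c someColour lv
          α , α≢γ , α≢δ = fresh-colour 3≤k γ δ
      in α , u-misses α α≢γ , v-misses α α≢δ

    heavy-light-missing : NoLightEdge H → (c : EdgeColouring H k) → ¬ Light u → Light v →
                          Σ (EdgeColouring H k) λ c' → MissingInCommon c' u v
    heavy-light-missing no-light c hu lv =
      let α , u-misses = misses-some-colour G H⊆G uv∈G uv∉H c (deg≤k u)
          γ , v-misses = misses-all-but-one G H⊆G vu∈G vu∉H c someColour lv
          β , β≢γ , _  = fresh-colour 3≤k γ γ
          c' , u-misses′ , v-misses′ =
            kempe-switch (does ∘ light?) (light-side-crossing {H} H⊆G no-light) c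
                         (dec-false (light? u) hu) (dec-true (light? v) lv) u-misses (v-misses β β≢γ)
      in c' , α , u-misses′ , v-misses′

  common-missing-colour : {H : Graph n} → H ⊆ᴳ G → ∀ {u v} → Adj G u v → ¬ Adj H u v →
              (Light u × Light v) ⊎ NoLightEdge H → (c : EdgeColouring H k) →
              Σ (EdgeColouring H k) λ c' → MissingInCommon c' u v
  common-missing-colour H⊆G uv∈G uv∉H (inj₁ (lu , lv)) c = c , light-light-missing H⊆G uv∈G uv∉H c lu lv
  common-missing-colour {H} H⊆G {u} {v} uv∈G uv∉H (inj₂ no-light) c with light? u | light? v
  ... | yes lu | yes lv = c , light-light-missing H⊆G uv∈G uv∉H c lu lv
  ... | no hu  | yes lv = heavy-light-missing H⊆G uv∈G uv∉H no-light c hu lv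
  ... | yes lu | no hv  =
    let c' , α , v-misses , u-misses = heavy-light-missing H⊆G (Adj-sym G uv∈G) (uv∉H ∘ Adj-sym H) no-light c hv lu
    in c' , α , u-misses , v-misses
  ... | no hu  | no hv  = contradiction (sparse u v uv∈G) [ hu , hv ]′

  extend : ∀ {L u v} → Adj G u v → (Light u × Light v) ⊎ NoLightEdge (G ↾ L) →
           EdgeColouring (G ↾ L) k → EdgeColouring (G ↾ ((u , v) ∷ L)) k
  extend {L} {u} {v} uv∈G condition c with T? (adj (G ↾ L) u v)
  ... | yes uv∈H = restrict (λ e → [ id , Adj-≡ᵘ (G ↾ L) uv∈H ]′ (↾-∷⁻ G (u , v) L e)) c
  ... | no uv∉H  =
    let c' , α , u-misses , v-misses = common-missing-colour (↾-⊆ G L) uv∈G uv∉H condition c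
    in add-edge (↾-∷⁻ G (u , v) L) u≢v c' u-misses v-misses
    where
    u≢v : u ≢ v
    u≢v refl = Adj-irrefl G uv∈G

  HeavyEdge LightEdge : Fin n × Fin n → Set
  HeavyEdge (x , y) = Adj G x y × ¬ (Light x × Light y)
  LightEdge (x , y) = Adj G x y × (Light x × Light y)

  heavy-edges-no-light-edge : ∀ {L} → All HeavyEdge L → NoLightEdge (G ↾ L)
  heavy-edges-no-light-edge heavy e (lx , ly) with ↾⁻ G _ e
  ... | inj₁ xy∈L = proj₂ (All.lookup heavy xy∈L) (lx , ly)
  ... | inj₂ yx∈L = proj₂ (All.lookup heavy yx∈L) (ly , lx)

  colour-heavy : ∀ L → All HeavyEdge L → EdgeColouring (G ↾ L) k
  colour-heavy []      []                     = edgeless-colouring (↾-[] G)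
  colour-heavy (_ ∷ L) ((uv∈G , _) ∷ heavy) = extend uv∈G (inj₂ (heavy-edges-no-light-edge heavy)) (colour-heavy L heavy)

  colour-light : ∀ L {A} → All LightEdge L → EdgeColouring (G ↾ A) k → EdgeColouring (G ↾ (L ++ A)) k
  colour-light []      []                         c = c
  colour-light (_ ∷ L) ((uv∈G , light) ∷ lights) c = extend uv∈G (inj₁ light) (colour-light L lights c)

  heavy-edge? : ∀ p → Dec (HeavyEdge p)
  heavy-edge? (x , y) = T? (adj G x y) ×-dec ¬? (light? x ×-dec light? y)

  light-edge? : ∀ p → Dec (LightEdge p)
  light-edge? (x , y) = T? (adj G x y) ×-dec (light? x ×-dec light? y)

  pairs heavyEdges lightEdges : List (Fin n × Fin n)
  pairs      = cartesianProduct (allFin n) (allFin n)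
  heavyEdges = filter heavy-edge? pairs
  lightEdges = filter light-edge? pairs

  colouring : EdgeColouring G k
  colouring = restrict G⊆edges
    (colour-light lightEdges (all-filter light-edge? pairs) (colour-heavy heavyEdges (all-filter heavy-edge? pairs)))
    where
    G⊆edges : G ⊆ᴳ (G ↾ (lightEdges ++ heavyEdges))
    G⊆edges {x} {y} e = ↾⁺ G _ e (inj₁ listed)
      where
      xy∈pairs : (x , y) ∈ˡ pairs
      xy∈pairs = ∈-cartesianProduct⁺ (∈-allFin x) (∈-allFin y)

      listed : (x , y) ∈ˡ lightEdges ++ heavyEdges
      listed with light? x ×-dec light? y
      ... | yes light = ∈-++⁺ˡ (∈-filter⁺ light-edge? xy∈pairs (e , light))
      ... | no heavy  = ∈-++⁺ʳ lightEdges (∈-filter⁺ heavy-edge? xy∈pairs (e , heavy))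

lemma8 : ∀ {n} (G : Graph n) → TwoSparse G → 3 ≤ maxDeg G →
           EdgeColourable G (maxDeg G)
lemma8 G sparse 3≤Δ = TwoSparseColouring.colouring G sparse 3≤Δ (deg≤maxDeg G)
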